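{- For every pair of positive integers $k,h$ there exists an integer $\phi(k,h)$, depending only on $k$ and $h$, such that every asymptotic basis $A$ for $\mathbb{N}_0$ of order $h$ has at most $\phi(k,h)$ essential subsets of size at most $k$.
   Context: All sets are subsets of $\mathbb{N}_0=\{0,1,2,\dots\}$. For $A\subseteq\mathbb{N}_0$ with $0\in A$ and an integer $h\ge 1$, $hA=\{a_1+\cdots+a_h : a_1,\dots,a_h\in A\}$. A set $B\subseteq\mathbb{N}_0$ is an asymptotic basis of order $h$ if all but finitely many non-negative integers can be written as a sum of at most $h$ elements of $B$ (for $0\in B$ this says $\mathbb{N}_0\setminus hB$ is finite); $B$ is an asymptotic basis (of some order) if it is one of order $h$ for some $h$. If $A$ is an asymptotic basis, an essentiality of $A$ is a subset $P\subseteq A$ such that $A\setminus P$ is not an asymptotic basis of any order, and $P$ is minimal with respect to inclusion among subsets of $A$ with this property. A finite essentiality is called an essential subset of $A$. -}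

module Defs where

open import Level using (0ℓ)
open import Data.Nat using (ℕ; _≤_)
open import Data.List using (List; length)
open import Data.Nat.ListAction using (sum)
open import Data.List.Relation.Unary.All using (All)
open import Data.List.Relation.Unary.Unique.Propositional using (Unique)
open import Data.List.Membership.Propositional using (_∈_)
open import Data.Product using (Σ; ∃; _×_)
open import Relation.Nullary using (¬_)
open import Relation.Unary using (Pred; _⊆_; _∉_)
open import Relation.Binary.PropositionalEquality using (_≡_)

NSet : Set₁
NSet = Pred ℕ 0ℓ

SumOfAtMost : ℕ → NSet → ℕ → Set
SumOfAtMost h B n =
  Σ (List ℕ) λ xs → (length xs ≤ h) × All B xs × (sum xs ≡ n)

IsAsymptoticBasisOfOrder : ℕ → NSet → Set
IsAsymptoticBasisOfOrder h B = ∃ λ N → ∀ n → N ≤ n → SumOfAtMost h B n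

IsAsymptoticBasis : NSet → Set
IsAsymptoticBasis B = ∃ λ h → IsAsymptoticBasisOfOrder h B

_∖_ : NSet → NSet → NSet
(A ∖ P) n = A n × n ∉ P

IsEssentiality : NSet → NSet → Set₁
IsEssentiality A P =
  (P ⊆ A) × ¬ IsAsymptoticBasis (A ∖ P) ×
  (∀ (Q : NSet) → Q ⊆ P → ¬ IsAsymptoticBasis (A ∖ Q) → P ⊆ Q)

setOf : List ℕ → NSet
setOf xs n = n ∈ xs

-- An essential subset of A of size at most k, given by a duplicate-free
-- list of its elements (so its cardinality is the list's length).
IsEssentialSubsetOfSizeAtMost : ℕ → NSet → List ℕ → Set₁
IsEssentialSubsetOfSizeAtMost k A xs =
  Unique xs × length xs ≤ k × IsEssentiality A (setOf xs)

DifferentSets : List ℕ → List ℕ → Set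
DifferentSets xs ys = ¬ ((setOf xs ⊆ setOf ys) × (setOf ys ⊆ setOf xs))

module Submission where

-- Let P be essential and B = A ∖ P.  Some g ≥ 2 divides every element of B:
-- otherwise a Euclidean descent on differences of sums of elements of B
-- yields two such sums differing by 1 (gap1), and then B represents every
-- large number (frobenius, gap1⇒basis), contradicting that B is no basis.
-- Minimality of P forces P = {a ∈ A : g ∤ a} (essential-separates), so
-- distinct essential subsets have distinct separators g.  Every residue mod g
-- is the residue of a sum of at most h elements of P, so g ≤ (|P|+1)^h
-- (divisor≤).  Counting separators (labelled-length≤) gives the bound.
-- Constructively the separator is only obtained under double negation, which
-- suffices because the final inequality is decidable.

open import Defs
open import Data.Nat using (ℕ; zero; suc; _+_; _*_; _∸_; _^_; _≤_; _<_; z≤n; s≤s; NonZero; >-nonZero; _≟_; _≤?_)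
open import Data.Nat.Properties
open import Data.Nat.DivMod
open import Data.Nat.Divisibility using (_∣_; divides; _∣?_; _∣0; ∣m∣n⇒∣m+n; ∣m+n∣m⇒∣n; ∣1⇒≡1; m%n≡0⇒n∣m)
open import Data.Nat.Induction using (<-rec)
open import Data.Nat.ListAction using (sum)
open import Data.Nat.ListAction.Properties using (sum-++)
open import Data.Nat.Tactic.RingSolver using (solve-∀)
open import Data.List using (List; []; _∷_; length; _++_; map; concatMap; lookup)
open import Data.List.Properties using (length-++; length-map)
open import Data.List.Relation.Unary.All as All using (All; []; _∷_)
open import Data.List.Relation.Unary.All.Properties using (++⁺)
open import Data.List.Relation.Unary.Any as Any using (here; there)
open import Data.List.Relation.Unary.Any.Properties using (lookup-index)
open import Data.List.Relation.Unary.AllPairs using (AllPairs; []; _∷_)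
open import Data.List.Membership.Propositional using (_∈_)
open import Data.List.Membership.Propositional.Properties using (∈-map⁺; ∈-++⁺ˡ; ∈-++⁺ʳ; ∈-lookup)
open import Data.List.Membership.DecPropositional _≟_ using (_∈?_)
open import Data.Fin as Fin using (Fin; toℕ; fromℕ<)
open import Data.Fin.Properties using (toℕ<n; toℕ-injective; toℕ-fromℕ<; injective⇒≤) renaming (<-cmp to <-cmpᶠ)
open import Data.Product using (∃; ∃₂; _×_; _,_; proj₁; proj₂)
open import Data.Empty using (⊥-elim)
open import Function using (_∘_)
open import Relation.Binary.Definitions using (tri<; tri≈; tri>)
open import Relation.Nullary using (¬_; yes; no)
open import Relation.Nullary.Decidable using (decidable-stable)
open import Relation.Unary using (_⊆_)
open import Relation.Binary.PropositionalEquality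

sumOfAtMost-zero : ∀ {h B} → SumOfAtMost h B 0
sumOfAtMost-zero = [] , z≤n , [] , refl

sumOfAtMost-single : ∀ {B a} → B a → SumOfAtMost 1 B a
sumOfAtMost-single {a = a} Ba = a ∷ [] , ≤-refl , Ba ∷ [] , +-identityʳ a

sumOfAtMost-mono : ∀ {h h' B n} → h ≤ h' → SumOfAtMost h B n → SumOfAtMost h' B n
sumOfAtMost-mono h≤h' (xs , len , Bxs , eq) = xs , ≤-trans len h≤h' , Bxs , eq

sumOfAtMost-+ : ∀ {h h' B m n} → SumOfAtMost h B m → SumOfAtMost h' B n →
                SumOfAtMost (h + h') B (m + n)
sumOfAtMost-+ (xs , lx , Bxs , ex) (ys , ly , Bys , ey) =
  xs ++ ys , subst (_≤ _) (sym (length-++ xs)) (+-mono-≤ lx ly) ,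
  ++⁺ Bxs Bys , trans (sum-++ xs ys) (cong₂ _+_ ex ey)

sumOfAtMost-* : ∀ c {h B n} → SumOfAtMost h B n → SumOfAtMost (c * h) B (c * n)
sumOfAtMost-* zero    _ = sumOfAtMost-zero
sumOfAtMost-* (suc c) r = sumOfAtMost-+ r (sumOfAtMost-* c r)

_DividesAll_ : ℕ → NSet → Set
g DividesAll C = ∀ {a} → C a → g ∣ a

∣-sum : ∀ {d} xs → All (d ∣_) xs → d ∣ sum xs
∣-sum []       []            = _ ∣0
∣-sum (x ∷ xs) (d∣x ∷ d∣xs) = ∣m∣n⇒∣m+n d∣x (∣-sum xs d∣xs)

-- A set all of whose elements share a divisor d ≥ 2 misses the residue 1
-- mod d, so it is not an asymptotic basis.
commonDivisor⇒¬basis : ∀ {C d} → 2 ≤ d → d DividesAll C → ¬ IsAsymptoticBasis C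
commonDivisor⇒¬basis {d = d} 2≤d d∣C (_ , N , represent)
  with represent (N * d + 1) (≤-trans (m≤m*n N d) (m≤m+n (N * d) 1))
  where instance _ : NonZero d
                 _ = >-nonZero (≤-trans (s≤s z≤n) 2≤d)
... | xs , _ , Cxs , sum≡ = <-irrefl refl (≤-trans 2≤d (≤-reflexive (∣1⇒≡1 d∣1)))
  where
  d∣1 : d ∣ 1
  d∣1 = ∣m+n∣m⇒∣n (subst (d ∣_) sum≡ (∣-sum xs (All.map d∣C Cxs))) (divides N refl)

record Split (A : NSet) (P L : List ℕ) : Set where
  field
    inside outside : List ℕ
    inside∈P       : All (_∈ P) inside
    outside∉P      : All (A ∖ setOf P) outside
    length-inside  : length inside ≤ length L
    length-outside : length outside ≤ length L
    sum-split      : sum L ≡ sum inside + sum outside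

split : ∀ {A} P L → All A L → Split A P L
split P [] [] = record
  { inside = [] ; outside = [] ; inside∈P = [] ; outside∉P = []
  ; length-inside = z≤n ; length-outside = z≤n ; sum-split = refl }
split P (x ∷ L) (Ax ∷ AL) with split P L AL | x ∈? P
... | s | yes x∈P = record
  { inside = x ∷ inside ; outside = outside
  ; inside∈P = x∈P ∷ inside∈P ; outside∉P = outside∉P
  ; length-inside = s≤s length-inside ; length-outside = m≤n⇒m≤1+n length-outside
  ; sum-split = trans (cong (x +_) sum-split) (sym (+-assoc x (sum inside) (sum outside))) }
  where open Split s
... | s | no x∉P = record
  { inside = inside ; outside = x ∷ outside
  ; inside∈P = inside∈P ; outside∉P = (Ax , x∉P) ∷ outside∉P
  ; length-inside = m≤n⇒m≤1+n length-inside ; length-outside = s≤s length-outside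
  ; sum-split = trans (cong (x +_) sum-split) (swap x (sum inside) (sum outside)) }
  where
  open Split s
  swap : ∀ x i o → x + (i + o) ≡ i + (x + o)
  swap = solve-∀

∈⇒≤sum : ∀ {x} P → x ∈ P → x ≤ sum P
∈⇒≤sum (p ∷ P) (here refl) = m≤m+n p (sum P)
∈⇒≤sum (p ∷ P) (there x∈P) = ≤-trans (∈⇒≤sum P x∈P) (m≤n+m (sum P) p)

sum≤length*sum : ∀ {P} xs → All (_∈ P) xs → sum xs ≤ length xs * sum P
sum≤length*sum []       []           = z≤n
sum≤length*sum (x ∷ xs) (x∈P ∷ xs∈P) = +-mono-≤ (∈⇒≤sum _ x∈P) (sum≤length*sum xs xs∈P)

-- All sums of at most h elements of P (with repetitions), listed as sums of
-- exactly h elements of 0 ∷ P.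
boundedSums : ℕ → List ℕ → List ℕ
boundedSums zero    P = 0 ∷ []
boundedSums (suc h) P = concatMap (λ x → map (x +_) (boundedSums h P)) (0 ∷ P)

length-boundedSums : ∀ h P → length (boundedSums h P) ≡ suc (length P) ^ h
length-boundedSums zero    P = refl
length-boundedSums (suc h) P = length-concat (0 ∷ P)
  where
  S = boundedSums h P
  length-concat : ∀ xs → length (concatMap (λ x → map (x +_) S) xs) ≡ length xs * suc (length P) ^ h
  length-concat []       = refl
  length-concat (x ∷ xs) = begin
    length (map (x +_) S ++ concatMap (λ x → map (x +_) S) xs)
      ≡⟨ length-++ (map (x +_) S) ⟩
    length (map (x +_) S) + length (concatMap (λ x → map (x +_) S) xs)
      ≡⟨ cong₂ _+_ (trans (length-map (x +_) S) (length-boundedSums h P)) (length-concat xs) ⟩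
    suc (length P) ^ h + length xs * suc (length P) ^ h ∎
    where open ≡-Reasoning

boundedSums-step : ∀ h P {y t} → y ∈ 0 ∷ P → t ∈ boundedSums h P → y + t ∈ boundedSums (suc h) P
boundedSums-step h P = go (0 ∷ P)
  where
  go : ∀ xs {y t} → y ∈ xs → t ∈ boundedSums h P →
       y + t ∈ concatMap (λ x → map (x +_) (boundedSums h P)) xs
  go (x ∷ xs) (here refl) t∈ = ∈-++⁺ˡ (∈-map⁺ (x +_) t∈)
  go (x ∷ xs) (there y∈)  t∈ = ∈-++⁺ʳ (map (x +_) (boundedSums h P)) (go xs y∈ t∈)

sum∈boundedSums : ∀ h {P} xs → All (_∈ P) xs → length xs ≤ h → sum xs ∈ boundedSums h P
sum∈boundedSums zero    []       []           _         = here refl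
sum∈boundedSums (suc h) {P} []   []           _         =
  boundedSums-step h P (here refl) (sum∈boundedSums h [] [] z≤n)
sum∈boundedSums (suc h) {P} (x ∷ xs) (x∈P ∷ xs∈P) (s≤s le) =
  boundedSums-step h P (there x∈P) (sum∈boundedSums h xs xs∈P le)

-- If d ≥ 1 divides every element of A outside P and A is a basis of order h,
-- then every residue mod d is the residue of a sum of at most h elements of
-- P; hence d ≤ (|P|+1)^h.
divisor≤ : ∀ {A h d} P → IsAsymptoticBasisOfOrder h A → 1 ≤ d →
           d DividesAll (A ∖ setOf P) → d ≤ suc (length P) ^ h
divisor≤ {A} {h} {d} P (N , represent) 1≤d d∣ =
  subst (d ≤_) (length-boundedSums h P) (injective⇒≤ {f = index} index-injective)
  where
  instance _ : NonZero d
           _ = >-nonZero 1≤d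
  S = boundedSums h P

  witness : (i : Fin d) → ∃ λ t → t ∈ S × toℕ i ≡ t % d
  witness i with represent (toℕ i + N * d) (≤-trans (m≤m*n N d) (m≤n+m (N * d) (toℕ i)))
  ... | L , len , AL , sum≡ with split P L AL | ∣-sum _ (All.map d∣ (Split.outside∉P (split P L AL)))
  ...   | s | divides q outside≡ =
    sum inside , sum∈boundedSums h inside inside∈P (≤-trans length-inside len) , (begin
      toℕ i                          ≡⟨ sym (m<n⇒m%n≡m (toℕ<n i)) ⟩
      toℕ i % d                      ≡⟨ sym ([m+kn]%n≡m%n (toℕ i) N d) ⟩
      (toℕ i + N * d) % d            ≡⟨ cong (_% d) (trans (sym sum≡) sum-split) ⟩
      (sum inside + sum outside) % d ≡⟨ cong (λ o → (sum inside + o) % d) outside≡ ⟩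
      (sum inside + q * d) % d       ≡⟨ [m+kn]%n≡m%n (sum inside) q d ⟩
      sum inside % d                 ∎)
    where
    open Split s
    open ≡-Reasoning

  index : Fin d → Fin (length S)
  index i = Any.index (proj₁ (proj₂ (witness i)))

  residue-index : ∀ i → toℕ i ≡ lookup S (index i) % d
  residue-index i = trans (proj₂ (proj₂ (witness i))) (cong (_% d) (lookup-index (proj₁ (proj₂ (witness i)))))

  index-injective : ∀ {i j} → index i ≡ index j → i ≡ j
  index-injective {i} {j} eq = toℕ-injective
    (trans (residue-index i) (trans (cong (λ x → lookup S x % d) eq) (sym (residue-index j))))

Gap : NSet → ℕ → Set
Gap B g = ∃₂ λ l s → SumOfAtMost l B (g + s) × SumOfAtMost l B s

element-gap : ∀ {B a} → B a → Gap B a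
element-gap {B} {a} Ba =
  1 , 0 , subst (SumOfAtMost 1 B) (sym (+-identityʳ a)) (sumOfAtMost-single Ba) , sumOfAtMost-zero

-- Euclid step: with q = a / g, the identity a + q·s = (a % g) + q·(g + s)
-- turns a gap g and an element a into the gap a % g.
gap-mod : ∀ {B g a} .{{_ : NonZero g}} → Gap B g → B a → Gap B (a % g)
gap-mod {B} {g} {a} (l , s , big , small) Ba =
  suc (q * l) , q * (g + s) ,
  subst (SumOfAtMost _ B) euclid (sumOfAtMost-+ (sumOfAtMost-single Ba) (sumOfAtMost-* q small)) ,
  sumOfAtMost-mono (n≤1+n _) (sumOfAtMost-* q big)
  where
  q = a / g
  regroup : ∀ r q g s → r + q * g + q * s ≡ r + q * (g + s)
  regroup = solve-∀
  euclid : a + q * s ≡ a % g + q * (g + s)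
  euclid = trans (cong (_+ q * s) (m≡m%n+[m/n]*n a g)) (regroup (a % g) q g s)

-- If no g ≥ 2 divides all of B (double-negated), then 1 is a gap of B: a
-- gap g ≥ 2 is reduced to a % g for an a ∈ B with g ∤ a, and the first gap
-- is an odd element of B.
gap1 : ∀ {B} → (∀ g → 2 ≤ g → ¬ ¬ (∃ λ a → B a × ¬ g ∣ a)) → ¬ ¬ Gap B 1
gap1 {B} indivisible k = indivisible 2 ≤-refl λ (a , Ba , 2∤a) →
  descent a (n≢0⇒n>0 λ { refl → 2∤a (2 ∣0) }) (element-gap Ba) k
  where
  Reducible : ℕ → Set
  Reducible g = 1 ≤ g → Gap B g → ¬ ¬ Gap B 1

  descent : ∀ g → Reducible g
  descent = <-rec Reducible step
    where
    step : ∀ g → (∀ {g'} → g' < g → Reducible g') → Reducible g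
    step g rec 1≤g gap with g ≟ 1
    ... | yes refl = λ k → k gap
    ... | no g≢1   = λ k → indivisible g (≤∧≢⇒< 1≤g (g≢1 ∘ sym)) λ (a , Ba , g∤a) →
      let instance _ : NonZero g
                   _ = >-nonZero 1≤g
      in rec (m%n<n a g) (n≢0⇒n>0 (g∤a ∘ m%n≡0⇒n∣m a g)) (gap-mod gap Ba) k

-- Every m ≥ s² is u·s + v·(s+1) with u, v ≤ m: write m = q·s + r with
-- r < s ≤ q and take u = q - r, v = r.
frobenius : ∀ s m → s * s ≤ m → ∃₂ λ u v → u * s + v * suc s ≡ m × u ≤ m × v ≤ m
frobenius zero    m _    = 0 , m , *-identityʳ m , z≤n , ≤-refl
frobenius s@(suc _) m s²≤m = q ∸ r , r , combination , ≤-trans (m∸n≤m q r) (m/n≤m m s) , m%n≤m m s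
  where
  q = m / s
  r = m % s
  s≤q : s ≤ q
  s≤q = subst (_≤ q) (m*n/n≡m s s) (/-monoˡ-≤ s s²≤m)
  r≤q : r ≤ q
  r≤q = ≤-trans (<⇒≤ (m%n<n m s)) s≤q
  regroup : ∀ u r s → u * s + r * suc s ≡ r + (u + r) * s
  regroup = solve-∀
  combination : (q ∸ r) * s + r * suc s ≡ m
  combination = begin
    (q ∸ r) * s + r * suc s ≡⟨ regroup (q ∸ r) r s ⟩
    r + (q ∸ r + r) * s     ≡⟨ cong (λ x → r + x * s) (m∸n+n≡m r≤q) ⟩
    r + q * s               ≡⟨ sym (m≡m%n+[m/n]*n m s) ⟩
    m                       ∎
    where open ≡-Reasoning

gap1-represents : ∀ {B l s m} → SumOfAtMost l B (1 + s) → SumOfAtMost l B s → s * s ≤ m →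
                  SumOfAtMost (m * l + m * l) B m
gap1-represents {B} {l} {s} {m} big small s²≤m with frobenius s m s²≤m
... | u , v , combination , u≤m , v≤m =
  sumOfAtMost-mono (+-mono-≤ (*-monoˡ-≤ l u≤m) (*-monoˡ-≤ l v≤m))
    (subst (SumOfAtMost _ B) combination (sumOfAtMost-+ (sumOfAtMost-* u small) (sumOfAtMost-* v big)))

-- If A is a basis of order h and 1 is a gap of A ∖ P, then A ∖ P is a basis:
-- for large n, write n - s² as a sum of elements of A and replace the part
-- r ≤ h·ΣP lying in P by a representation of s² + r.
gap1⇒basis : ∀ {A h} P → IsAsymptoticBasisOfOrder h A → Gap (A ∖ setOf P) 1 →
             IsAsymptoticBasis (A ∖ setOf P)
gap1⇒basis {A} {h} P (N , represent) (l , s , big , small) =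
  h + (R * l + R * l) , N + s * s , representB
  where
  R = s * s + h * sum P
  representB : ∀ n → N + s * s ≤ n → SumOfAtMost (h + (R * l + R * l)) (A ∖ setOf P) n
  representB n N+s²≤n with represent (n ∸ s * s) (m+n≤o⇒m≤o∸n N N+s²≤n)
  ... | L , len , AL , sum≡ = subst (SumOfAtMost _ _) total (sumOfAtMost-+ rest filler)
    where
    open Split (split P L AL)
    r = sum inside
    r≤ : r ≤ h * sum P
    r≤ = ≤-trans (sum≤length*sum inside inside∈P) (*-monoˡ-≤ (sum P) (≤-trans length-inside len))
    rest : SumOfAtMost h (A ∖ setOf P) (sum outside)
    rest = outside , ≤-trans length-outside len , outside∉P , refl
    filler : SumOfAtMost (R * l + R * l) (A ∖ setOf P) (s * s + r)
    filler = sumOfAtMost-mono (+-mono-≤ bound bound) (gap1-represents big small (m≤m+n (s * s) r))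
      where bound = *-monoˡ-≤ l (+-monoʳ-≤ (s * s) r≤)
    regroup : ∀ o c r → o + (c + r) ≡ r + o + c
    regroup = solve-∀
    total : sum outside + (s * s + r) ≡ n
    total = begin
      sum outside + (s * s + r) ≡⟨ regroup (sum outside) (s * s) r ⟩
      r + sum outside + s * s   ≡⟨ cong (_+ s * s) (trans (sym sum-split) sum≡) ⟩
      n ∸ s * s + s * s         ≡⟨ m∸n+n≡m (≤-trans (m≤n+m (s * s) N) N+s²≤n) ⟩
      n                         ∎
      where open ≡-Reasoning

Separates : NSet → List ℕ → ℕ → Set
Separates A P g = setOf P ⊆ A × g DividesAll (A ∖ setOf P) × (∀ {a} → a ∈ P → ¬ g ∣ a)

separator-unique : ∀ {A P P' g} → Separates A P g → Separates A P' g → ¬ DifferentSets P P'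
separator-unique sep sep' different = different (included sep sep' , included sep' sep)
  where
  included : ∀ {A P P' g} → Separates A P g → Separates A P' g → setOf P ⊆ setOf P'
  included {P' = P'} {g} (P⊆A , _ , g∤P) (_ , g∣A∖P' , _) {a} a∈P =
    decidable-stable (a ∈? P') λ a∉P' → g∤P a∈P (g∣A∖P' (P⊆A a∈P , a∉P'))

-- By minimality, a g ≥ 2 dividing all of A ∖ P separates P: the elements of
-- A not divisible by g form a subset Q ⊆ P whose removal leaves a non-basis,
-- so P ⊆ Q.
essential-separates : ∀ {A P g} → IsEssentiality A (setOf P) → 2 ≤ g →
                      g DividesAll (A ∖ setOf P) → Separates A P g
essential-separates {A} {P} {g} (P⊆A , _ , minimal) 2≤g g∣ =
  P⊆A , g∣ , λ a∈P → proj₂ (minimal Q Q⊆P ¬basis a∈P)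
  where
  Q : NSet
  Q a = A a × ¬ g ∣ a
  Q⊆P : Q ⊆ setOf P
  Q⊆P {a} (Aa , g∤a) = decidable-stable (a ∈? P) λ a∉P → g∤a (g∣ (Aa , a∉P))
  ¬basis : ¬ IsAsymptoticBasis (A ∖ Q)
  ¬basis = commonDivisor⇒¬basis 2≤g λ {a} (Aa , a∉Q) →
    decidable-stable (g ∣? a) λ g∤a → a∉Q (Aa , g∤a)

-- For an essential P, some g ≥ 2 divides all of A ∖ P: otherwise 1 is a gap
-- of A ∖ P, which would then be a basis.
essential⇒¬¬divisor : ∀ {A h P} → IsAsymptoticBasisOfOrder h A → IsEssentiality A (setOf P) →
                      ¬ ¬ (∃ λ g → 2 ≤ g × g DividesAll (A ∖ setOf P))
essential⇒¬¬divisor {A} {P = P} basisA (_ , ¬basis , _) noDivisor =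
  gap1 indivisible (¬basis ∘ gap1⇒basis P basisA)
  where
  indivisible : ∀ g → 2 ≤ g → ¬ ¬ (∃ λ a → (A ∖ setOf P) a × ¬ g ∣ a)
  indivisible g 2≤g allDivisible = noDivisor (g , 2≤g , λ {a} Ba →
    decidable-stable (g ∣? a) λ g∤a → allDivisible (a , Ba , g∤a))

essential⇒¬¬separator : ∀ {A k h P} → IsAsymptoticBasisOfOrder h A →
                        IsEssentialSubsetOfSizeAtMost k A P →
                        ¬ ¬ (∃ λ g → g < suc (suc k ^ h) × Separates A P g)
essential⇒¬¬separator {A} {k} {h} {P} basisA (_ , |P|≤k , essential) noSeparator =
  essential⇒¬¬divisor basisA essential λ (g , 2≤g , g∣) →
    noSeparator (g , s≤s (small g∣ 2≤g) , essential-separates essential 2≤g g∣)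
  where
  small : ∀ {g} → g DividesAll (A ∖ setOf P) → 2 ≤ g → g ≤ suc k ^ h
  small g∣ 2≤g = ≤-trans (divisor≤ P basisA (≤-trans (s≤s z≤n) 2≤g) g∣) (^-monoˡ-≤ h (s≤s |P|≤k))

allPairs-lookup : ∀ {X : Set} {R : X → X → Set} {xs : List X} → AllPairs R xs →
                  ∀ {i j : Fin (length xs)} → i Fin.< j → R (lookup xs i) (lookup xs j)
allPairs-lookup (Rx ∷ _)   {Fin.zero}  {Fin.suc j} _         = All.lookup Rx (∈-lookup j)
allPairs-lookup (_ ∷ Rxs)  {Fin.suc i} {Fin.suc j} (s≤s i<j) = allPairs-lookup Rxs i<j

labelled-length≤ : ∀ {X : Set} {R : X → X → Set} (Label : X → ℕ → Set) →
                   (∀ {x y g} → Label x g → Label y g → ¬ R x y) →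
                   ∀ n {xs} → All (λ x → ∃ λ g → g < n × Label x g) xs → AllPairs R xs →
                   length xs ≤ n
labelled-length≤ {R = R} Label clash n {xs} labels related = injective⇒≤ {f = code} code-injective
  where
  labelOf : (i : Fin (length xs)) → ∃ λ g → g < n × Label (lookup xs i) g
  labelOf i = All.lookup labels (∈-lookup i)

  code : Fin (length xs) → Fin n
  code i = fromℕ< (proj₁ (proj₂ (labelOf i)))

  same-label : ∀ {i j} → code i ≡ code j → proj₁ (labelOf i) ≡ proj₁ (labelOf j)
  same-label {i} {j} eq =
    trans (sym (toℕ-fromℕ< _)) (trans (cong toℕ eq) (toℕ-fromℕ< (proj₁ (proj₂ (labelOf j)))))

  unrelated : ∀ {i j} → code i ≡ code j → ¬ R (lookup xs i) (lookup xs j)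
  unrelated {i} {j} eq = clash (proj₂ (proj₂ (labelOf i)))
    (subst (Label (lookup xs j)) (sym (same-label eq)) (proj₂ (proj₂ (labelOf j))))

  code-injective : ∀ {i j} → code i ≡ code j → i ≡ j
  code-injective {i} {j} eq with <-cmpᶠ i j
  ... | tri< i<j _ _ = ⊥-elim (unrelated eq (allPairs-lookup related i<j))
  ... | tri≈ _ i≡j _ = i≡j
  ... | tri> _ _ j<i = ⊥-elim (unrelated (sym eq) (allPairs-lookup related j<i))

¬¬-all : ∀ {X : Set} {Q : X → Set} {xs : List X} → All (λ x → ¬ ¬ Q x) xs → ¬ ¬ All Q xs
¬¬-all []       k = k []
¬¬-all (q ∷ qs) k = q λ q' → ¬¬-all qs λ qs' → k (q' ∷ qs')

theorem2p1 : ∀ (k h : ℕ) → 1 ≤ k → 1 ≤ h →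
    ∃ λ (φ : ℕ) → ∀ (A : NSet) → IsAsymptoticBasisOfOrder h A →
    ∀ (Ps : List (List ℕ)) →
    All (IsEssentialSubsetOfSizeAtMost k A) Ps →
    AllPairs DifferentSets Ps →
    length Ps ≤ φ
theorem2p1 k h _ _ = suc (suc k ^ h) , λ A basisA Ps essential different →
  decidable-stable (length Ps ≤? suc (suc k ^ h)) λ tooMany →
    ¬¬-all (All.map (essential⇒¬¬separator basisA) essential) λ separators →
      tooMany (labelled-length≤ (Separates A) separator-unique _ separators different)
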